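{- Let $\tau\ge1$ be an integer and let $0<\kappa\le1$. Let $\mathcal{B}=(B_1,\ldots,B_K)$ be a blockade in a graph. Then there is an equicardinal $(\kappa,\tau)$-support-invariant contraction $\mathcal{B}'=(B_1',\ldots,B_K')$ of $\mathcal{B}$ with width at least $\kappa^{2^K\tau^\tau}$ times the width of $\mathcal{B}$.
   Context: A blockade in a graph $G$ is a sequence $(B_i:i\in I)$ of pairwise disjoint nonempty subsets (blocks) of $V(G)$, $I$ a finite set of integers; its width is the minimum block size; it is equicardinal if all blocks have the same size. A contraction of $(B_i:i\in I)$ is a blockade $(B_i':i\in I)$ with $\emptyset\neq B_i'\subseteq B_i$. An induced subgraph $H$ is $\mathcal{B}$-rainbow if each vertex lies in some block and no two lie in the same block; its support is the set of $i$ with $V(H)\cap B_i\ne\emptyset$; its $\mathcal{B}$-ordering orders $u<v$ if $u\in B_i$, $v\in B_j$ with $i<j$. An ordered tree is a tree with a linear order on its vertices (natural isomorphism notion). The trace of an ordered tree $J$ relative to $\mathcal{B}$ is the set of supports of all $\mathcal{B}$-rainbow induced subgraphs whose $\mathcal{B}$-ordering is isomorphic to $J$. $\mathcal{B}$ is $(\kappa,\tau)$-support-invariant if for every contraction $\mathcal{B}''$ of $\mathcal{B}$ of width at least $\kappa$ times the width of $\mathcal{B}$ and every ordered tree $J$ with $|J|\le\tau$, the traces of $J$ relative to $\mathcal{B}$ and to $\mathcal{B}''$ are equal.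
   Formalization: The parameter κ ranges over the rationals in the interval (0,1]. -}

module Defs where

open import Data.Nat as ℕ using (ℕ; zero; suc; _⊓_)
open import Data.Nat.Base using (_<_) renaming (_≤_ to _≤ℕ_)
open import Data.Integer using (+_)
open import Data.Rational using (ℚ; 1ℚ; _*_; _/_) renaming (_≤_ to _≤ℚ_)
open import Data.Fin using (Fin; toℕ; inject₁; fromℕ) renaming (zero to fzero; suc to fsuc)
open import Data.Fin.Subset using (Subset; _∈_; _⊆_; Nonempty; Empty; _∩_; ∣_∣)
open import Data.Bool using (Bool; true; false)
open import Data.Product using (Σ; ∃; _×_; _,_)
open import Function.Definitions using (Injective)
open import Relation.Binary.PropositionalEquality using (_≡_; _≢_)
open import Relation.Nullary using (¬_)
open import Function.Bundles using (_⇔_)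

ℕ→ℚ : ℕ → ℚ
ℕ→ℚ n = (+ n) / 1

_^ℚ_ : ℚ → ℕ → ℚ
q ^ℚ zero  = 1ℚ
q ^ℚ suc k = q * (q ^ℚ k)

record Graph (n : ℕ) : Set where
  field
    adj      : Fin n → Fin n → Bool
    symmetric : ∀ u v → adj u v ≡ adj v u
    irreflexive : ∀ u → adj u u ≡ false

open Graph public

-- Ordered trees: a tree on vertex set Fin m, linearly ordered by the
-- natural order of Fin m.  (Every ordered tree is isomorphic to exactly
-- such a one, isomorphism of ordered graphs being an order-preserving
-- adjacency-preserving bijection.)

Connected : ∀ {m} → Graph m → Set
Connected {m} T = ∀ (a b : Fin m) → ∃ λ k → Σ (Fin (suc k) → Fin m) λ f →
  (f fzero ≡ a) × (f (fromℕ k) ≡ b) ×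
  (∀ (i : Fin k) → adj T (f (inject₁ i)) (f (fsuc i)) ≡ true)

HasCycle : ∀ {m} → Graph m → Set
HasCycle {m} T = ∃ λ k → Σ (Fin (suc (suc (suc k))) → Fin m) λ f →
  Injective _≡_ _≡_ f ×
  (∀ (i : Fin (suc (suc k))) → adj T (f (inject₁ i)) (f (fsuc i)) ≡ true) ×
  (adj T (f (fromℕ (suc (suc k)))) (f fzero) ≡ true)

record OrderedTree (m : ℕ) : Set where
  field
    graph     : Graph m
    nonempty  : 1 ≤ℕ m
    connected : Connected graph
    acyclic   : ¬ HasCycle graph

open OrderedTree public

-- Blockades with index set {1,...,K}, represented as Fin K (in order)

record Blockade {n : ℕ} (G : Graph n) (K : ℕ) : Set where
  field
    block    : Fin K → Subset n
    nonempty : ∀ i → Nonempty (block i)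
    disjoint : ∀ i j → i ≢ j → Empty (block i ∩ block j)

open Blockade public

-- width = minimum block size (convention: 0 when there are no blocks)
minSize : ∀ {n} K → (Fin K → Subset n) → ℕ
minSize zero B = 0
minSize (suc zero) B = ∣ B fzero ∣
minSize (suc (suc K)) B = ∣ B fzero ∣ ⊓ minSize (suc K) (λ i → B (fsuc i))

width : ∀ {n} {G : Graph n} {K} → Blockade G K → ℕ
width {K = K} 𝓑 = minSize K (block 𝓑)

Equicardinal : ∀ {n} {G : Graph n} {K} → Blockade G K → Set
Equicardinal 𝓑 = ∀ i j → ∣ block 𝓑 i ∣ ≡ ∣ block 𝓑 j ∣

_ContractionOf_ : ∀ {n} {G : Graph n} {K} → Blockade G K → Blockade G K → Set
𝓑' ContractionOf 𝓑 = ∀ i → block 𝓑' i ⊆ block 𝓑 i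

-- A 𝓑-rainbow induced subgraph H whose 𝓑-ordering is isomorphic to the
-- ordered tree J (on Fin m) is given by the isomorphism φ : Fin m → V(H)
-- together with σ a = the index of the block containing φ a.  The
-- 𝓑-ordering being preserved means σ is strictly increasing; rainbow means
-- the σ a are distinct (implied); induced means adjacency agrees.

RainbowCopy : ∀ {n} {G : Graph n} {K m} → Blockade G K → OrderedTree m →
              (Fin m → Fin n) → (Fin m → Fin K) → Set
RainbowCopy {G = G} {m = m} 𝓑 J φ σ =
  Injective _≡_ _≡_ φ ×
  (∀ a → φ a ∈ block 𝓑 (σ a)) ×
  (∀ (a b : Fin m) → toℕ a < toℕ b → toℕ (σ a) < toℕ (σ b)) ×
  (∀ (a b : Fin m) → adj G (φ a) (φ b) ≡ adj (graph J) a b)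

InTrace : ∀ {n} {G : Graph n} {K m} → Blockade G K → OrderedTree m → Subset K → Set
InTrace {n = n} {K = K} {m = m} 𝓑 J S =
  Σ (Fin m → Fin n) λ φ → Σ (Fin m → Fin K) λ σ →
    RainbowCopy 𝓑 J φ σ × (∀ (i : Fin K) → (i ∈ S) ⇔ (∃ λ a → σ a ≡ i))

SameTrace : ∀ {n} {G : Graph n} {K m} → Blockade G K → Blockade G K → OrderedTree m → Set
SameTrace {K = K} 𝓑 𝓑'' J = ∀ (S : Subset K) → InTrace 𝓑 J S ⇔ InTrace 𝓑'' J S

SupportInvariant : ∀ {n} {G : Graph n} {K} → ℚ → ℕ → Blockade G K → Set
SupportInvariant {G = G} {K = K} κ τ 𝓑 =
  ∀ (𝓑'' : Blockade G K) → 𝓑'' ContractionOf 𝓑 →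
    κ * ℕ→ℚ (width 𝓑) ≤ℚ ℕ→ℚ (width 𝓑'') →
    ∀ (m : ℕ) → m ≤ℕ τ → (J : OrderedTree m) → SameTrace 𝓑 𝓑'' J

-- A code is a pair (S, c) of a set S of block indices and a vector c ∈ (Fin τ)^τ read as
-- the parent function of a tree: every tree on at most τ vertices is determined by the
-- parent map of its breadth-first search from the least vertex, so 2^K τ^τ codes describe
-- every (support, ordered tree) pair a trace can contain.  The potential of a blockade is
-- the number of codes realised by its rainbow copies; it can only drop under contraction.
-- If a blockade is not (κ,τ)-support-invariant, a κ-wide contraction loses a support from
-- some trace and so strictly lowers the potential.  Iterating, at most 2^K τ^τ steps, each
-- costing a factor κ of width, reach a support-invariant contraction, and trimming every
-- block to the minimum block size keeps both invariance and the width.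

module Submission where

open import Defs
open import Data.Nat as ℕ using (ℕ; zero; suc; _+_; _*_; _^_; _∸_; _⊓_; _≤_; _<_; _≤?_; z≤n; s≤s)
open import Data.Nat using () renaming (_≤_ to _≤ℕ_)
import Data.Nat.Properties as ℕ
open import Data.Nat.Induction using (<-wellFounded)
open import Data.Rational as ℚ using (ℚ; 0ℚ; 1ℚ; nonNegative) renaming (_<_ to _<ℚ_; _≤_ to _≤ℚ_; _*_ to _*ℚ_)
import Data.Rational.Properties as ℚ
open import Data.Bool as Bool using (Bool; true; false)
import Data.Bool.Properties as Bool
open import Data.Fin using (_≟_; Fin; toℕ; fromℕ; fromℕ<; inject₁; inject≤; punchIn; punchOut) renaming (zero to fzero; suc to fsuc)
open import Data.Fin.Properties using (toℕ<n; toℕ-injective; toℕ-fromℕ<; toℕ-inject₁; toℕ-inject≤; toℕ-fromℕ; suc-injective; 0≢1+n; punchIn-injective; punchInᵢ≢i; punchOut-injective; punchIn-punchOut)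
import Data.Fin.Properties as Fin
open import Data.Fin.Subset using (Subset; inside; outside; ∣_∣; Nonempty; Empty; _∩_) renaming (⊥ to ∅; _∈_ to _∈ₛ_; _⊆_ to _⊆ₛ_)
open import Data.Fin.Subset.Properties using (drop-there; _∈?_; _⊆?_; nonempty?; ⊆-refl; ⊆-reflexive; ⊆-trans; x∈p∩q⁺; x∈p∩q⁻; ⊥⊆; s⊆s; out⊆; ∣⊥∣≡0)
open import Data.Vec using (Vec; []; _∷_; here; there; lookup; tabulate)
open import Data.Vec.Properties using (lookup∘tabulate)
open import Data.List using (List; []; _∷_; _++_; length; map; cartesianProductWith; allFin)
open import Data.List.Properties using (length-++; length-map; length-tabulate)
open import Data.List.Membership.Propositional using (_∈_; lose)
open import Data.List.Membership.Propositional.Properties using (∈-cartesianProductWith⁺; ∈-allFin)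
open import Data.List.Relation.Unary.Any using (here; there; any?; satisfied)
open import Data.Product using (Σ; ∃; _×_; _,_; proj₁; proj₂)
open import Data.Sum as Sum using (_⊎_; inj₁; inj₂)
open import Function using (_∘_; _⇔_; mk⇔; Equivalence)
open import Function.Definitions using (Injective)
open import Function.Construct.Composition using (_⇔-∘_)
open import Function.Construct.Symmetry using (⇔-sym)
open import Induction.WellFounded using (Acc; acc)
open import Relation.Binary.Definitions using (DecidableEquality; tri<; tri≈; tri>)
open import Relation.Binary.PropositionalEquality using (_≡_; _≢_; refl; sym; trans; cong; cong₂; subst; subst₂; _≗_; module ≡-Reasoning)
open import Relation.Nullary using (¬_; Dec; yes; no; does; decidable-stable; contradiction; ¬?; _×-dec_; _⊎-dec_; _→-dec_)
open import Relation.Nullary.Decidable using (map′; dec-true; dec-false; does-⇔)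
open import Relation.Unary using (Decidable; _⊆_)

-- Enumerations and counting

record Enumeration (A : Set) : Set where
  field
    elements : List A
    complete : ∀ x → x ∈ elements

open Enumeration

search : ∀ {A : Set} {P : A → Set} → Enumeration A → Decidable P → Dec (∃ P)
search e P? = map′ satisfied (λ (x , px) → lose (complete e x) px) (any? P? (elements e))

enumFin : ∀ n → Enumeration (Fin n)
enumFin n = record { elements = allFin n ; complete = ∈-allFin }

enumBool : Enumeration Bool
enumBool = record
  { elements = true ∷ false ∷ []
  ; complete = λ { true → here refl ; false → there (here refl) }
  }

length-cartesianProductWith : ∀ {A B C : Set} (f : A → B → C) xs ys →
  length (cartesianProductWith f xs ys) ≡ length xs * length ys
length-cartesianProductWith f []       ys = refl
length-cartesianProductWith f (x ∷ xs) ys = begin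
  length (map (f x) ys ++ cartesianProductWith f xs ys)        ≡⟨ length-++ (map (f x) ys) ⟩
  length (map (f x) ys) + length (cartesianProductWith f xs ys) ≡⟨ cong₂ _+_ (length-map (f x) ys)
                                                                          (length-cartesianProductWith f xs ys) ⟩
  length ys + length xs * length ys                             ∎
  where open ≡-Reasoning

enumPair : ∀ {A B} → Enumeration A → Enumeration B → Enumeration (A × B)
enumPair eA eB = record
  { elements = cartesianProductWith _,_ (elements eA) (elements eB)
  ; complete = λ (x , y) → ∈-cartesianProductWith⁺ _,_ (complete eA x) (complete eB y)
  }

enumVec : ∀ {A} → Enumeration A → ∀ m → Enumeration (Vec A m)
enumVec eA zero    = record { elements = [] ∷ [] ; complete = λ { [] → here refl } }
enumVec eA (suc m) = record
  { elements = cartesianProductWith _∷_ (elements eA) (elements (enumVec eA m))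
  ; complete = λ { (x ∷ v) → ∈-cartesianProductWith⁺ _∷_ (complete eA x) (complete (enumVec eA m) v) }
  }

size : ∀ {A} → Enumeration A → ℕ
size e = length (elements e)

size-enumFin : ∀ n → size (enumFin n) ≡ n
size-enumFin n = length-tabulate (λ i → i)

size-enumPair : ∀ {A B} (eA : Enumeration A) (eB : Enumeration B) → size (enumPair eA eB) ≡ size eA * size eB
size-enumPair eA eB = length-cartesianProductWith _,_ (elements eA) (elements eB)

size-enumVec : ∀ {A} (eA : Enumeration A) m → size (enumVec eA m) ≡ size eA ^ m
size-enumVec eA zero    = refl
size-enumVec eA (suc m) = begin
  size (enumVec eA (suc m))           ≡⟨ length-cartesianProductWith _∷_ (elements eA) (elements (enumVec eA m)) ⟩
  size eA * size (enumVec eA m)       ≡⟨ cong (size eA *_) (size-enumVec eA m) ⟩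
  size eA * size eA ^ m               ∎
  where open ≡-Reasoning

count : ∀ {A : Set} {P : A → Set} → Decidable P → List A → ℕ
count P? [] = 0
count P? (x ∷ xs) with P? x
... | yes _ = suc (count P? xs)
... | no _  = count P? xs

count-≤-length : ∀ {A : Set} {P : A → Set} (P? : Decidable P) xs → count P? xs ≤ length xs
count-≤-length P? [] = z≤n
count-≤-length P? (x ∷ xs) with P? x
... | yes _ = s≤s (count-≤-length P? xs)
... | no _  = ℕ.m≤n⇒m≤1+n (count-≤-length P? xs)

module _ {A : Set} {P Q : A → Set} (P? : Decidable P) (Q? : Decidable Q) (Q⊆P : Q ⊆ P) where

  count-mono : ∀ xs → count Q? xs ≤ count P? xs
  count-mono [] = z≤n
  count-mono (x ∷ xs) with P? x | Q? x
  ... | yes _ | yes _ = s≤s (count-mono xs)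
  ... | yes _ | no _  = ℕ.m≤n⇒m≤1+n (count-mono xs)
  ... | no ¬p | yes q = contradiction (Q⊆P q) ¬p
  ... | no _  | no _  = count-mono xs

  count-mono-< : ∀ {y} xs → y ∈ xs → P y → ¬ Q y → count Q? xs < count P? xs
  count-mono-< (x ∷ xs) (here refl) py ¬qy with P? x | Q? x
  ... | yes _ | yes qy = contradiction qy ¬qy
  ... | yes _ | no _   = s≤s (count-mono xs)
  ... | no ¬p | _      = contradiction py ¬p
  count-mono-< (x ∷ xs) (there y∈) py ¬qy with P? x | Q? x
  ... | yes _ | yes _ = s≤s (count-mono-< xs y∈ py ¬qy)
  ... | yes _ | no _  = ℕ.m≤n⇒m≤1+n (count-mono-< xs y∈ py ¬qy)
  ... | no ¬p | yes q = contradiction (Q⊆P q) ¬p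
  ... | no _  | no _  = count-mono-< xs y∈ py ¬qy

-- Supports

IsSupport : ∀ {m K} → Subset K → (Fin m → Fin K) → Set
IsSupport S σ = ∀ i → i ∈ₛ S ⇔ ∃ λ a → σ a ≡ i

module _ {m K} {S : Subset K} {σ : Fin m → Fin (suc K)} where

  avoidsZero : IsSupport (outside ∷ S) σ → ∀ a → fzero ≢ σ a
  avoidsZero sup a σa≡0 with () ← Equivalence.from (sup fzero) (a , sym σa≡0)

  shiftDown : IsSupport (outside ∷ S) σ → Fin m → Fin K
  shiftDown sup a = punchOut (avoidsZero sup a)

  fsuc-shiftDown : (sup : IsSupport (outside ∷ S) σ) → ∀ a → fsuc (shiftDown sup a) ≡ σ a
  fsuc-shiftDown sup a = punchIn-punchOut (avoidsZero sup a)

  shiftDown-injective : Injective _≡_ _≡_ σ → (sup : IsSupport (outside ∷ S) σ) →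
                        Injective _≡_ _≡_ (shiftDown sup)
  shiftDown-injective inj sup = inj ∘ punchOut-injective (avoidsZero sup _) (avoidsZero sup _)

  IsSupport-shiftDown : (sup : IsSupport (outside ∷ S) σ) → IsSupport S (shiftDown sup)
  IsSupport-shiftDown sup i = mk⇔
    (λ i∈S → let a , σa≡ = Equivalence.to (sup (fsuc i)) (there i∈S) in
             a , suc-injective (trans (fsuc-shiftDown sup a) σa≡))
    (λ (a , e) → drop-there (Equivalence.from (sup (fsuc i)) (a , trans (sym (fsuc-shiftDown sup a)) (cong fsuc e))))

IsSupport-removeZero : ∀ {m K} {S : Subset K} {σ : Fin (suc m) → Fin (suc K)} {a₀} →
  Injective _≡_ _≡_ σ → σ a₀ ≡ fzero → IsSupport (inside ∷ S) σ → IsSupport (outside ∷ S) (σ ∘ punchIn a₀)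
IsSupport-removeZero {a₀ = a₀} inj σa₀≡0 sup fzero = mk⇔ (λ ())
  (λ (a , e) → contradiction (inj (trans e (sym σa₀≡0))) (punchInᵢ≢i a₀ a))
IsSupport-removeZero {σ = σ} {a₀} inj σa₀≡0 sup (fsuc i) = mk⇔
  (λ i∈ → let a , σa≡ = Equivalence.to (sup (fsuc i)) (there (drop-there i∈))
              a₀≢a : a₀ ≢ a
              a₀≢a a₀≡a = 0≢1+n (trans (sym σa₀≡0) (trans (cong σ a₀≡a) σa≡))
          in punchOut a₀≢a , trans (cong σ (punchIn-punchOut a₀≢a)) σa≡)
  (λ (a , e) → there (drop-there (Equivalence.from (sup (fsuc i)) (punchIn a₀ a , e))))

∣support∣≡ : ∀ {m K} (S : Subset K) (σ : Fin m → Fin K) → Injective _≡_ _≡_ σ → IsSupport S σ → ∣ S ∣ ≡ m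
∣support∣≡ {zero} [] σ inj sup = refl
∣support∣≡ {suc m} [] σ inj sup with () ← σ fzero
∣support∣≡ (outside ∷ S) σ inj sup = ∣support∣≡ S _ (shiftDown-injective inj sup) (IsSupport-shiftDown sup)
∣support∣≡ {zero} (inside ∷ S) σ inj sup with () ← Equivalence.to (sup fzero) here
∣support∣≡ {suc m} (inside ∷ S) σ inj sup with a₀ , σa₀≡0 ← Equivalence.to (sup fzero) here =
  cong suc (∣support∣≡ S _ (shiftDown-injective (punchIn-injective a₀ _ _ ∘ inj) sup′) (IsSupport-shiftDown sup′))
  where sup′ = IsSupport-removeZero inj σa₀≡0 sup

-- Trees as parent functions

minimal : {P : ℕ → Set} → Decidable P → ∀ {k} → P k → Σ ℕ λ d → P d × (∀ j → P j → d ≤ j)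
minimal {P} P? = go _ (<-wellFounded _)
  where
  go : ∀ k → Acc _<_ k → P k → Σ ℕ λ d → P d × (∀ j → P j → d ≤ j)
  go k (acc rec) pk with Fin.any? (λ (j : Fin k) → P? (toℕ j))
  ... | yes (j , pj) = go (toℕ j) (rec (toℕ<n j)) pj
  ... | no none      = k , pk , λ j pj → ℕ.≮⇒≥ λ j<k →
                         none (fromℕ< j<k , subst P (sym (toℕ-fromℕ< j<k)) pj)

∸≡suc∸suc : ∀ {a N} → a < N → N ∸ a ≡ suc (N ∸ suc a)
∸≡suc∸suc {zero}  {suc N} _         = refl
∸≡suc∸suc {suc a} {suc N} (s≤s a<N) = ∸≡suc∸suc a<N

ParentEdge : ∀ {A : Set} → (A → A) → A → A → Set
ParentEdge p a b = a ≢ b × (p a ≡ b ⊎ p b ≡ a)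

parentEdge? : ∀ {A : Set} → DecidableEquality A → (p : A → A) → ∀ a b → Dec (ParentEdge p a b)
parentEdge? _≟_ p a b = ¬? (a ≟ b) ×-dec (p a ≟ b ⊎-dec p b ≟ a)

ParentEdge-embed : ∀ {A B : Set} {g : A → B} {f : B → B} {p : A → A} →
  Injective _≡_ _≡_ g → (∀ a → f (g a) ≡ g (p a)) → ∀ a b → ParentEdge f (g a) (g b) ⇔ ParentEdge p a b
ParentEdge-embed {g = g} {f} {p} inj fg≡gp a b = mk⇔
  (λ (ga≢gb , parent) → ga≢gb ∘ cong g ,
     Sum.map (λ e → inj (trans (sym (fg≡gp a)) e)) (λ e → inj (trans (sym (fg≡gp b)) e)) parent)
  (λ (a≢b , parent) → a≢b ∘ inj ,
     Sum.map (λ e → trans (fg≡gp a) (cong g e)) (λ e → trans (fg≡gp b) (cong g e)) parent)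

module _ {m} (T : Graph m) where

  private
    _~_ : Fin m → Fin m → Set
    u ~ v = adj T u v ≡ true

  ~-sym : ∀ {u v} → u ~ v → v ~ u
  ~-sym {u} {v} u~v = trans (symmetric T v u) u~v

  ~-irrefl : ∀ {u} → ¬ u ~ u
  ~-irrefl {u} u~u with () ← trans (sym u~u) (irreflexive T u)

  WalkUpTo : ℕ → (ℕ → Fin m) → Set
  WalkUpTo N g = ∀ a → a < N → g a ~ g (suc a)

  InjectiveUpTo : ℕ → (ℕ → Fin m) → Set
  InjectiveUpTo N g = ∀ a b → a ≤ N → b ≤ N → g a ≡ g b → a ≡ b

  closedWalk⇒HasCycle : ∀ (g : ℕ → Fin m) N → 2 ≤ N → InjectiveUpTo N g → WalkUpTo N g → g N ~ g 0 →
                        HasCycle T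
  closedWalk⇒HasCycle g (suc zero) (s≤s ())
  closedWalk⇒HasCycle g (suc (suc k)) _ inj walk closing = k , g ∘ toℕ , inj′ , walk′ , closing′
    where
    inj′ : Injective _≡_ _≡_ (g ∘ toℕ)
    inj′ {x} {y} = toℕ-injective ∘ inj _ _ (ℕ.s≤s⁻¹ (toℕ<n x)) (ℕ.s≤s⁻¹ (toℕ<n y))
    walk′ : ∀ i → g (toℕ (inject₁ i)) ~ g (suc (toℕ i))
    walk′ i = subst (λ a → g a ~ g (suc (toℕ i))) (sym (toℕ-inject₁ i)) (walk (toℕ i) (toℕ<n i))
    closing′ : g (toℕ (fromℕ (suc (suc k)))) ~ g 0
    closing′ = subst (λ a → g a ~ g 0) (sym (toℕ-fromℕ _)) closing

  twoPaths⇒HasCycle : ∀ (P Q : ℕ → Fin m) i j → 2 ≤ i + j →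
    WalkUpTo i P → WalkUpTo j Q → InjectiveUpTo i P → InjectiveUpTo j Q →
    P i ≡ Q j → (∀ a b → a ≤ i → b ≤ j → P a ≡ Q b → a ≡ i) → P 0 ~ Q 0 → HasCycle T
  twoPaths⇒HasCycle P Q i j 2≤i+j walkP walkQ injP injQ Pi≡Qj meet P0~Q0 =
    closedWalk⇒HasCycle g N 2≤i+j injective walk (subst₂ _~_ (sym gN≡Q0) (sym g0≡P0) (~-sym P0~Q0))
    where
    N = i + j

    -- the cycle P 0, …, P i = Q j, …, Q 0, closed by the edge Q 0 ~ P 0
    g : ℕ → Fin m
    g a with a ≤? i
    ... | yes _ = P a
    ... | no _  = Q (N ∸ a)

    N∸i≡j : N ∸ i ≡ j
    N∸i≡j = ℕ.m+n∸m≡n i j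

    g-left : ∀ {a} → a ≤ i → g a ≡ P a
    g-left {a} a≤i with a ≤? i
    ... | yes _   = refl
    ... | no a≰i = contradiction a≤i a≰i

    g-right : ∀ {a} → i ≤ a → g a ≡ Q (N ∸ a)
    g-right {a} i≤a with a ≤? i
    ... | no _ = refl
    ... | yes a≤i rewrite ℕ.≤-antisym a≤i i≤a = trans Pi≡Qj (cong Q (sym N∸i≡j))

    N∸a≤j : ∀ {a} → i ≤ a → N ∸ a ≤ j
    N∸a≤j {a} i≤a = subst (N ∸ a ≤_) N∸i≡j (ℕ.∸-monoʳ-≤ N i≤a)

    g0≡P0 : g 0 ≡ P 0
    g0≡P0 = g-left z≤n

    gN≡Q0 : g N ≡ Q 0
    gN≡Q0 = trans (g-right (ℕ.m≤m+n i j)) (cong Q (ℕ.n∸n≡0 N))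

    walk : WalkUpTo N g
    walk a a<N = Sum.[ alongP , alongQ ]′ (ℕ.<-≤-connex a i)
      where
      alongP : a < i → g a ~ g (suc a)
      alongP a<i = subst₂ _~_ (sym (g-left (ℕ.<⇒≤ a<i))) (sym (g-left a<i)) (walkP a a<i)
      alongQ : i ≤ a → g a ~ g (suc a)
      alongQ i≤a = subst₂ _~_ (sym (trans (g-right i≤a) (cong Q (∸≡suc∸suc a<N))))
                              (sym (g-right (ℕ.m≤n⇒m≤1+n i≤a)))
                              (~-sym (walkQ (N ∸ suc a) (subst (_≤ j) (∸≡suc∸suc a<N) (N∸a≤j i≤a))))

    crossing : ∀ {a b} → a ≤ i → i < b → b ≤ N → g a ≢ g b
    crossing {a} {b} a≤i i<b b≤N ga≡gb = ℕ.<-irrefl N∸b≡j (subst (N ∸ b <_) N∸i≡j (ℕ.∸-monoʳ-< i<b b≤N))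
      where
      Pa≡Q[N∸b] : P a ≡ Q (N ∸ b)
      Pa≡Q[N∸b] = trans (sym (g-left a≤i)) (trans ga≡gb (g-right (ℕ.<⇒≤ i<b)))
      N∸b≡j : N ∸ b ≡ j
      N∸b≡j = injQ _ _ (N∸a≤j (ℕ.<⇒≤ i<b)) ℕ.≤-refl
        (trans (sym Pa≡Q[N∸b]) (trans (cong P (meet a _ a≤i (N∸a≤j (ℕ.<⇒≤ i<b)) Pa≡Q[N∸b])) Pi≡Qj))

    injective : InjectiveUpTo N g
    injective a b a≤N b≤N ga≡gb with ℕ.≤-<-connex a i | ℕ.≤-<-connex b i
    ... | inj₁ a≤i | inj₁ b≤i = injP a b a≤i b≤i (trans (sym (g-left a≤i)) (trans ga≡gb (g-left b≤i)))
    ... | inj₁ a≤i | inj₂ i<b = contradiction ga≡gb (crossing a≤i i<b b≤N)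
    ... | inj₂ i<a | inj₁ b≤i = contradiction (sym ga≡gb) (crossing b≤i i<a a≤N)
    ... | inj₂ i<a | inj₂ i<b = ℕ.∸-cancelˡ-≡ a≤N b≤N (injQ _ _ (N∸a≤j (ℕ.<⇒≤ i<a)) (N∸a≤j (ℕ.<⇒≤ i<b))
                                  (trans (sym (g-right (ℕ.<⇒≤ i<a))) (trans ga≡gb (g-right (ℕ.<⇒≤ i<b)))))

module RootedTree {m} (T : OrderedTree (suc m)) where

  private
    V = Fin (suc m)

    _~_ : V → V → Set
    u ~ v = adj (graph T) u v ≡ true

  root : V
  root = fzero

  WalkFromRoot : ℕ → V → Set
  WalkFromRoot zero    v = v ≡ root
  WalkFromRoot (suc k) v = ∃ λ w → WalkFromRoot k w × w ~ v

  walkFromRoot? : ∀ k v → Dec (WalkFromRoot k v)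
  walkFromRoot? zero    v = v ≟ root
  walkFromRoot? (suc k) v = Fin.any? λ w → walkFromRoot? k w ×-dec (adj (graph T) w v Bool.≟ true)

  walk⇒WalkFromRoot : ∀ k (f : Fin (suc k) → V) → f fzero ≡ root →
                      (∀ i → f (inject₁ i) ~ f (fsuc i)) → WalkFromRoot k (f (fromℕ k))
  walk⇒WalkFromRoot zero    f f0≡root steps = f0≡root
  walk⇒WalkFromRoot (suc k) f f0≡root steps =
    f (inject₁ (fromℕ k)) , walk⇒WalkFromRoot k (f ∘ inject₁) f0≡root (steps ∘ inject₁) , steps (fromℕ k)

  reachable : ∀ v → ∃ λ k → WalkFromRoot k v
  reachable v with k , f , f0≡root , fk≡v , steps ← connected T root v =
    k , subst (WalkFromRoot k) fk≡v (walk⇒WalkFromRoot k f f0≡root steps)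

  opaque
    shortestWalk : ∀ v → Σ ℕ λ d → WalkFromRoot d v × (∀ k → WalkFromRoot k v → d ≤ k)
    shortestWalk v = minimal (λ k → walkFromRoot? k v) (proj₂ (reachable v))

  depth : V → ℕ
  depth v = proj₁ (shortestWalk v)

  walkFromRoot-depth : ∀ v → WalkFromRoot (depth v) v
  walkFromRoot-depth v = proj₁ (proj₂ (shortestWalk v))

  depth-minimal : ∀ v k → WalkFromRoot k v → depth v ≤ k
  depth-minimal v = proj₂ (proj₂ (shortestWalk v))

  depth-root : depth root ≡ 0
  depth-root = ℕ.n≤0⇒n≡0 (depth-minimal root 0 refl)

  depth≡0⇒root : ∀ {v} → depth v ≡ 0 → v ≡ root
  depth≡0⇒root {v} d≡0 = subst (λ k → WalkFromRoot k v) d≡0 (walkFromRoot-depth v)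

  depth-~ : ∀ {u v} → u ~ v → depth v ≤ suc (depth u)
  depth-~ {u} {v} u~v = depth-minimal v (suc (depth u)) (u , walkFromRoot-depth u , u~v)

  parent-exists : ∀ v → v ≢ root → ∃ λ w → w ~ v × suc (depth w) ≡ depth v
  parent-exists v v≢root = lastStep (depth v) (walkFromRoot-depth v) refl
    where
    lastStep : ∀ k → WalkFromRoot k v → k ≡ depth v → ∃ λ w → w ~ v × suc (depth w) ≡ depth v
    lastStep zero    v≡root         _      = contradiction v≡root v≢root
    lastStep (suc k) (w , walk , w~v) k+1≡d = w , w~v ,
      ℕ.≤-antisym (subst (suc (depth w) ≤_) k+1≡d (s≤s (depth-minimal w k walk))) (depth-~ w~v)

  parent : V → V
  parent v with v ≟ root
  ... | yes _       = root
  ... | no v≢root = proj₁ (parent-exists v v≢root)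

  parent-root : parent root ≡ root
  parent-root with root ≟ root
  ... | yes _          = refl
  ... | no root≢root = contradiction refl root≢root

  parent-~ : ∀ {v} → v ≢ root → v ~ parent v
  parent-~ {v} v≢root with v ≟ root
  ... | yes v≡root = contradiction v≡root v≢root
  ... | no v≢root′ = ~-sym (graph T) (proj₁ (proj₂ (parent-exists v v≢root′)))

  depth-parent : ∀ {v} → v ≢ root → suc (depth (parent v)) ≡ depth v
  depth-parent {v} v≢root with v ≟ root
  ... | yes v≡root = contradiction v≡root v≢root
  ... | no v≢root′ = proj₂ (proj₂ (parent-exists v v≢root′))

  ancestor : ℕ → V → V
  ancestor zero    v = v
  ancestor (suc k) v = parent (ancestor k v)

  depth>0⇒≢root : ∀ {w} → 0 < depth w → w ≢ root
  depth>0⇒≢root 0<d refl = ℕ.<-irrefl (sym depth-root) 0<d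

  depth-ancestor : ∀ k v → k ≤ depth v → depth (ancestor k v) + k ≡ depth v
  ancestor≢root : ∀ {k v} → k < depth v → ancestor k v ≢ root

  depth-ancestor zero    v _   = ℕ.+-identityʳ (depth v)
  depth-ancestor (suc k) v k<d = begin
    depth (parent w) + suc k   ≡⟨ ℕ.+-suc (depth (parent w)) k ⟩
    suc (depth (parent w)) + k ≡⟨ cong (_+ k) (depth-parent (ancestor≢root k<d)) ⟩
    depth w + k                ≡⟨ depth-ancestor k v (ℕ.<⇒≤ k<d) ⟩
    depth v                    ∎
    where
    open ≡-Reasoning
    w = ancestor k v

  ancestor≢root {k} {v} k<d = depth>0⇒≢root
    (ℕ.+-cancelʳ-< k 0 _ (subst (k <_) (sym (depth-ancestor k v (ℕ.<⇒≤ k<d))) k<d))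

  ancestor-depth : ∀ v → ancestor (depth v) v ≡ root
  ancestor-depth v = depth≡0⇒root (ℕ.+-cancelʳ-≡ _ _ 0 (depth-ancestor (depth v) v ℕ.≤-refl))

  ancestor-~ : ∀ {k v} → k < depth v → ancestor k v ~ ancestor (suc k) v
  ancestor-~ k<d = parent-~ (ancestor≢root k<d)

  ancestor-injective : ∀ v → InjectiveUpTo (graph T) (depth v) (λ k → ancestor k v)
  ancestor-injective v a b a≤d b≤d eq = ℕ.+-cancelˡ-≡ (depth (ancestor a v)) a b (begin
    depth (ancestor a v) + a ≡⟨ depth-ancestor a v a≤d ⟩
    depth v                  ≡⟨ sym (depth-ancestor b v b≤d) ⟩
    depth (ancestor b v) + b ≡⟨ cong (λ x → depth x + b) (sym eq) ⟩
    depth (ancestor a v) + b ∎)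
    where open ≡-Reasoning

  -- Climb from u to the first vertex on the path from v to the root; together with the edge
  -- u v these two paths close a cycle unless u is the parent of v.
  nonParentEdge⇒HasCycle : ∀ {u v} → u ~ v → depth u ≤ depth v → parent v ≢ u → HasCycle (graph T)
  nonParentEdge⇒HasCycle {u} {v} u~v du≤dv pv≢u =
    twoPaths⇒HasCycle (graph T) P Q i j 2≤i+j walkP walkQ injP injQ (sym Qj≡Pi) meet u~v
    where
    P Q : ℕ → V
    P a = ancestor a u
    Q b = ancestor b v

    Meets : ℕ → Set
    Meets a = ∃ λ (b : Fin (suc (depth v))) → Q (toℕ b) ≡ P a

    meets : ∀ {a} b → b ≤ depth v → Q b ≡ P a → Meets a
    meets b b≤dv eq = fromℕ< (s≤s b≤dv) , trans (cong Q (toℕ-fromℕ< (s≤s b≤dv))) eq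

    meets-root : Meets (depth u)
    meets-root = meets {depth u} (depth v) ℕ.≤-refl (trans (ancestor-depth v) (sym (ancestor-depth u)))

    firstMeeting : Σ ℕ λ i → Meets i × (∀ a → Meets a → i ≤ a)
    firstMeeting = minimal (λ a → Fin.any? λ (b : Fin (suc (depth v))) → Q (toℕ b) ≟ P a) {depth u} meets-root

    i : ℕ
    i = proj₁ firstMeeting

    j′ : Fin (suc (depth v))
    j′ = proj₁ (proj₁ (proj₂ firstMeeting))

    j : ℕ
    j = toℕ j′

    Qj≡Pi : Q j ≡ P i
    Qj≡Pi = proj₂ (proj₁ (proj₂ firstMeeting))

    i-minimal : ∀ a → Meets a → i ≤ a
    i-minimal = proj₂ (proj₂ firstMeeting)

    i≤du : i ≤ depth u
    i≤du = i-minimal _ meets-root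

    j≤dv : j ≤ depth v
    j≤dv = ℕ.s≤s⁻¹ (toℕ<n j′)

    walkP : WalkUpTo (graph T) i P
    walkP a a<i = ancestor-~ (ℕ.<-≤-trans a<i i≤du)

    walkQ : WalkUpTo (graph T) j Q
    walkQ b b<j = ancestor-~ (ℕ.<-≤-trans b<j j≤dv)

    injP : InjectiveUpTo (graph T) i P
    injP a b a≤i b≤i = ancestor-injective u a b (ℕ.≤-trans a≤i i≤du) (ℕ.≤-trans b≤i i≤du)

    injQ : InjectiveUpTo (graph T) j Q
    injQ a b a≤j b≤j = ancestor-injective v a b (ℕ.≤-trans a≤j j≤dv) (ℕ.≤-trans b≤j j≤dv)

    meet : ∀ a b → a ≤ i → b ≤ j → P a ≡ Q b → a ≡ i
    meet a b a≤i b≤j Pa≡Qb = ℕ.≤-antisym a≤i (i-minimal a (meets {a} b (ℕ.≤-trans b≤j j≤dv) (sym Pa≡Qb)))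

    D : ℕ
    D = depth (P i)

    D+i≡du : D + i ≡ depth u
    D+i≡du = depth-ancestor i u i≤du

    D+j≡dv : D + j ≡ depth v
    D+j≡dv = trans (cong (λ x → depth x + j) (sym Qj≡Pi)) (depth-ancestor j v j≤dv)

    i≢0 : i ≢ 0
    i≢0 i≡0 = Sum.[ (λ j≡0 → ~-irrefl (graph T) (subst (u ~_) (trans (cong Q (sym j≡0)) Qj≡u) u~v))
                  , (λ j≡1 → pv≢u (trans (cong Q (sym j≡1)) Qj≡u)) ]′ (ℕ.n≤1⇒n≡0∨n≡1 j≤1)
      where
      Qj≡u : Q j ≡ u
      Qj≡u = trans Qj≡Pi (cong P i≡0)
      j≤1 : j ≤ 1
      j≤1 = ℕ.+-cancelˡ-≤ (depth u) j 1
              (subst₂ _≤_ (sym (trans (cong (λ x → depth x + j) (sym Qj≡u)) (depth-ancestor j v j≤dv)))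
                          (ℕ.+-comm 1 (depth u)) (depth-~ u~v))

    j≢0 : j ≢ 0
    j≢0 j≡0 = i≢0 (ℕ.n≤0⇒n≡0 (ℕ.+-cancelˡ-≤ D i 0
      (subst₂ _≤_ (sym D+i≡du) (trans (sym D+j≡dv) (cong (D +_) j≡0)) du≤dv)))

    2≤i+j : 2 ≤ i + j
    2≤i+j = ℕ.+-mono-≤ (ℕ.n≢0⇒n>0 i≢0) (ℕ.n≢0⇒n>0 j≢0)

  parent-of-deeper : ∀ {u v} → u ~ v → depth u ≤ depth v → parent v ≡ u
  parent-of-deeper {u} {v} u~v du≤dv =
    decidable-stable (parent v ≟ u) (acyclic T ∘ nonParentEdge⇒HasCycle u~v du≤dv)

  ~⇒ParentEdge : ∀ {u v} → u ~ v → ParentEdge parent u v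
  ~⇒ParentEdge {u} {v} u~v =
    (λ u≡v → ~-irrefl (graph T) (subst (u ~_) (sym u≡v) u~v)) ,
    Sum.[ inj₂ ∘ parent-of-deeper u~v , inj₁ ∘ parent-of-deeper (~-sym (graph T) u~v) ]′
      (ℕ.≤-total (depth u) (depth v))

  ParentEdge⇒~ : ∀ {u v} → ParentEdge parent u v → u ~ v
  ParentEdge⇒~ {u} {v} (u≢v , inj₁ pu≡v) = subst (u ~_) pu≡v (parent-~ (nonFixed⇒≢root pu≡v u≢v))
    where
    nonFixed⇒≢root : ∀ {x y} → parent x ≡ y → x ≢ y → x ≢ root
    nonFixed⇒≢root px≡y x≢y refl = x≢y (trans (sym parent-root) px≡y)
  ParentEdge⇒~ (u≢v , inj₂ pv≡u) = ~-sym (graph T) (ParentEdge⇒~ ((u≢v ∘ sym) , inj₁ pv≡u))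

  adj≡parentEdge : ∀ a b → adj (graph T) a b ≡ does (parentEdge? _≟_ parent a b)
  adj≡parentEdge a b with adj (graph T) a b in a~b
  ... | true  = sym (dec-true (parentEdge? _≟_ parent a b) (~⇒ParentEdge a~b))
  ... | false = sym (dec-false (parentEdge? _≟_ parent a b) (Bool.not-¬ a~b ∘ ParentEdge⇒~))

tree-parentFunction : ∀ {m} (T : OrderedTree m) →
  ∃ λ (p : Fin m → Fin m) → ∀ a b → adj (graph T) a b ≡ does (parentEdge? _≟_ p a b)
tree-parentFunction {zero}  T with () ← nonempty T
tree-parentFunction {suc m} T = parent , adj≡parentEdge
  where open RootedTree T

-- Traces and the potential

_⇔-dec_ : ∀ {A B : Set} → Dec A → Dec B → Dec (A ⇔ B)
A? ⇔-dec B? = map′ (λ (to , from) → mk⇔ to from) (λ A⇔B → Equivalence.to A⇔B , Equivalence.from A⇔B)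
                   ((A? →-dec B?) ×-dec (B? →-dec A?))

injective? : ∀ {m} {A : Set} → DecidableEquality A → (f : Fin m → A) → Dec (Injective _≡_ _≡_ f)
injective? _≟ᴬ_ f = map′ (λ inj → inj _ _) (λ inj _ _ → inj)
  (Fin.all? λ x → Fin.all? λ y → (f x ≟ᴬ f y) →-dec (x ≟ y))

Increasing : ∀ {m K} → (Fin m → Fin K) → Set
Increasing σ = ∀ a b → toℕ a < toℕ b → toℕ (σ a) < toℕ (σ b)

increasing⇒injective : ∀ {m K} {σ : Fin m → Fin K} → Increasing σ → Injective _≡_ _≡_ σ
increasing⇒injective {σ = σ} incr {a} {b} σa≡σb with ℕ.<-cmp (toℕ a) (toℕ b)
... | tri< a<b _ _ = contradiction (cong toℕ σa≡σb) (ℕ.<⇒≢ (incr a b a<b))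
... | tri≈ _ a≡b _ = toℕ-injective a≡b
... | tri> _ _ b<a = contradiction (cong toℕ (sym σa≡σb)) (ℕ.<⇒≢ (incr b a b<a))

module Traces {n} (G : Graph n) (K : ℕ) where

  Blocks : Set
  Blocks = Fin K → Subset n

  _⊆ᴮ_ : Blocks → Blocks → Set
  bl ⊆ᴮ bl′ = ∀ i → bl i ⊆ₛ bl′ i

  Copy : ∀ {m} → Blocks → (Fin m → Fin m → Bool) → (Fin m → Fin n) → (Fin m → Fin K) → Set
  Copy bl H φ σ = Injective _≡_ _≡_ φ × (∀ a → φ a ∈ₛ bl (σ a)) × Increasing σ ×
                  (∀ a b → adj G (φ a) (φ b) ≡ H a b)

  Trace : ∀ {m} → Blocks → (Fin m → Fin m → Bool) → Subset K → Set
  Trace {m} bl H S = Σ (Fin m → Fin n) λ φ → Σ (Fin m → Fin K) λ σ → Copy bl H φ σ × IsSupport S σ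

  module _ {m} {H : Fin m → Fin m → Bool} where

    Copy-mono : ∀ {bl bl′ φ σ} → bl ⊆ᴮ bl′ → Copy bl H φ σ → Copy bl′ H φ σ
    Copy-mono bl⊆bl′ (inj , mem , incr , adjacency) = inj , (λ a → bl⊆bl′ _ (mem a)) , incr , adjacency

    Copy-≗ : ∀ {bl φ φ′ σ σ′} → φ ≗ φ′ → σ ≗ σ′ → Copy bl H φ σ → Copy bl H φ′ σ′
    Copy-≗ {bl} φ≗φ′ σ≗σ′ (inj , mem , incr , adjacency) =
      (λ {a} {b} e → inj (trans (φ≗φ′ a) (trans e (sym (φ≗φ′ b))))) ,
      (λ a → subst₂ (λ x i → x ∈ₛ bl i) (φ≗φ′ a) (σ≗σ′ a) (mem a)) ,
      (λ a b a<b → subst₂ (λ x y → toℕ x < toℕ y) (σ≗σ′ a) (σ≗σ′ b) (incr a b a<b)) ,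
      (λ a b → trans (sym (cong₂ (adj G) (φ≗φ′ a) (φ≗φ′ b))) (adjacency a b))

    IsSupport-≗ : ∀ {S} {σ σ′ : Fin m → Fin K} → σ ≗ σ′ → IsSupport S σ → IsSupport S σ′
    IsSupport-≗ σ≗σ′ sup i = mk⇔
      (λ i∈S → let a , σa≡i = Equivalence.to (sup i) i∈S in a , trans (sym (σ≗σ′ a)) σa≡i)
      (λ (a , σ′a≡i) → Equivalence.from (sup i) (a , trans (σ≗σ′ a) σ′a≡i))

    copy? : ∀ bl φ σ → Dec (Copy bl H φ σ)
    copy? bl φ σ =
      injective? _≟_ φ
      ×-dec Fin.all? (λ a → φ a ∈? bl (σ a))
      ×-dec Fin.all? (λ a → Fin.all? λ b → (toℕ a ℕ.<? toℕ b) →-dec (toℕ (σ a) ℕ.<? toℕ (σ b)))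
      ×-dec Fin.all? (λ a → Fin.all? λ b → adj G (φ a) (φ b) Bool.≟ H a b)

    isSupport? : ∀ S (σ : Fin m → Fin K) → Dec (IsSupport S σ)
    isSupport? S σ = Fin.all? λ i → (i ∈? S) ⇔-dec Fin.any? (λ a → σ a ≟ i)

    trace? : ∀ bl S → Dec (Trace bl H S)
    trace? bl S = map′ fromVec toVec
      (search (enumVec (enumFin n) m) λ φ → search (enumVec (enumFin K) m) λ σ →
        copy? bl (lookup φ) (lookup σ) ×-dec isSupport? S (lookup σ))
      where
      fromVec : (∃ λ φ → ∃ λ σ → Copy bl H (lookup φ) (lookup σ) × IsSupport S (lookup σ)) → Trace bl H S
      fromVec (φ , σ , copy , sup) = lookup φ , lookup σ , copy , sup
      toVec : Trace bl H S → ∃ λ φ → ∃ λ σ → Copy bl H (lookup φ) (lookup σ) × IsSupport S (lookup σ)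
      toVec (φ , σ , copy , sup) = tabulate φ , tabulate σ ,
        Copy-≗ {bl} (sym ∘ lookup∘tabulate φ) (sym ∘ lookup∘tabulate σ) copy ,
        IsSupport-≗ (sym ∘ lookup∘tabulate σ) sup

  Trace-mono : ∀ {m} {H : Fin m → Fin m → Bool} {bl bl′ S} → bl ⊆ᴮ bl′ → Trace bl H S → Trace bl′ H S
  Trace-mono bl⊆bl′ (φ , σ , copy , sup) = φ , σ , Copy-mono bl⊆bl′ copy , sup

  Trace-adj : ∀ {m} {H H′ : Fin m → Fin m → Bool} {bl S} → (∀ a b → H a b ≡ H′ a b) → Trace bl H S → Trace bl H′ S
  Trace-adj H≡H′ (φ , σ , (inj , mem , incr , adjacency) , sup) =
    φ , σ , (inj , mem , incr , λ a b → trans (adjacency a b) (H≡H′ a b)) , sup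

  ∣support∣≡size : ∀ {m} {H : Fin m → Fin m → Bool} {bl S} → Trace bl H S → ∣ S ∣ ≡ m
  ∣support∣≡size {S = S} (φ , σ , (_ , _ , incr , _) , sup) = ∣support∣≡ S σ (increasing⇒injective incr) sup

-- A tree on m ≤ τ vertices is stored by its parent function in the first m entries of the
-- code; the other entries are irrelevant, and codeParent returns 0 beyond τ.
module TreeCodes (τ : ℕ) where

  ParentCode : Set
  ParentCode = Vec (Fin τ) τ

  codeParent : ParentCode → ℕ → ℕ
  codeParent c k with k ℕ.<? τ
  ... | yes k<τ = toℕ (lookup c (fromℕ< k<τ))
  ... | no _    = 0

  codeAdj : ParentCode → ∀ {m} → Fin m → Fin m → Bool
  codeAdj c a b = does (parentEdge? ℕ._≟_ (codeParent c) (toℕ a) (toℕ b))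

  module _ {m} (m≤τ : m ≤ τ) (p : Fin m → Fin m) where

    encodeEntry : Fin τ → Fin τ
    encodeEntry x with toℕ x ℕ.<? m
    ... | yes x<m = inject≤ (p (fromℕ< x<m)) m≤τ
    ... | no _    = x

    encode : ParentCode
    encode = tabulate encodeEntry

    toℕ-encodeEntry : ∀ {x a} → toℕ x ≡ toℕ a → toℕ (encodeEntry x) ≡ toℕ (p a)
    toℕ-encodeEntry {x} {a} x≡a with toℕ x ℕ.<? m
    ... | yes x<m = trans (toℕ-inject≤ _ m≤τ) (cong (toℕ ∘ p) (toℕ-injective (trans (toℕ-fromℕ< x<m) x≡a)))
    ... | no x≮m  = contradiction (subst (_< m) (sym x≡a) (toℕ<n a)) x≮m

    codeParent-encode : ∀ a → codeParent encode (toℕ a) ≡ toℕ (p a)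
    codeParent-encode a with toℕ a ℕ.<? τ
    ... | yes a<τ = trans (cong toℕ (lookup∘tabulate encodeEntry (fromℕ< a<τ))) (toℕ-encodeEntry (toℕ-fromℕ< a<τ))
    ... | no a≮τ  = contradiction (ℕ.<-≤-trans (toℕ<n a) m≤τ) a≮τ

    codeAdj-encode : ∀ a b → codeAdj encode a b ≡ does (parentEdge? _≟_ p a b)
    codeAdj-encode a b = does-⇔ (ParentEdge-embed {f = codeParent encode} {p} toℕ-injective codeParent-encode a b)
                           (parentEdge? ℕ._≟_ (codeParent encode) (toℕ a) (toℕ b)) (parentEdge? _≟_ p a b)

  tree-code : ∀ {m} → m ≤ τ → (J : OrderedTree m) → ∃ λ c → ∀ a b → codeAdj c a b ≡ adj (graph J) a b
  tree-code m≤τ J with p , adj≡parentEdge ← tree-parentFunction J =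
    encode m≤τ p , λ a b → trans (codeAdj-encode m≤τ p a b) (sym (adj≡parentEdge a b))

module Potential {n} (G : Graph n) (K τ : ℕ) where

  open Traces G K
  open TreeCodes τ

  Code : Set
  Code = Subset K × ParentCode

  codes : Enumeration Code
  codes = enumPair (enumVec enumBool K) (enumVec (enumFin τ) τ)

  size-codes : size codes ≡ 2 ^ K * τ ^ τ
  size-codes = trans (size-enumPair (enumVec enumBool K) (enumVec (enumFin τ) τ))
    (cong₂ _*_ (size-enumVec enumBool K) (trans (size-enumVec (enumFin τ) τ) (cong (_^ τ) (size-enumFin τ))))

  -- the number of tree vertices is not stored: it is ∣ S ∣, by ∣support∣≡size
  Realised : Blocks → Code → Set
  Realised bl (S , c) = Trace bl (codeAdj c {∣ S ∣}) S

  realised? : ∀ bl → Decidable (Realised bl)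
  realised? bl (S , c) = trace? bl S

  potential : Blocks → ℕ
  potential bl = count (realised? bl) (elements codes)

  potential-≤ : ∀ bl → potential bl ≤ 2 ^ K * τ ^ τ
  potential-≤ bl = subst (potential bl ≤_) size-codes (count-≤-length (realised? bl) (elements codes))

  potential-mono : ∀ {bl bl′} → bl ⊆ᴮ bl′ → potential bl ≤ potential bl′
  potential-mono bl⊆bl′ = count-mono (realised? _) (realised? _) (Trace-mono bl⊆bl′) (elements codes)

  potential-≗ : ∀ {bl bl′} → bl ≗ bl′ → potential bl ≡ potential bl′
  potential-≗ bl≗bl′ = ℕ.≤-antisym (potential-mono (λ i → ⊆-reflexive (bl≗bl′ i)))
                                   (potential-mono (λ i → ⊆-reflexive (sym (bl≗bl′ i))))

  potential-drop : ∀ {bl bl″ m S} → bl″ ⊆ᴮ bl → m ≤ τ → (J : OrderedTree m) →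
    Trace bl (adj (graph J)) S → ¬ Trace bl″ (adj (graph J)) S → potential bl″ < potential bl
  potential-drop {bl} {bl″} {S = S} bl″⊆bl m≤τ J t ¬t″ =
    count-mono-< (realised? bl) (realised? bl″) (Trace-mono {bl = bl″} {bl} bl″⊆bl) (elements codes)
      (complete codes (S , c)) toCode (¬t″ ∘ fromCode)
    where
    c = proj₁ (tree-code m≤τ J)
    c≡J = proj₂ (tree-code m≤τ J)
    ∣S∣≡m = ∣support∣≡size {bl = bl} t

    toCode : Realised bl (S , c)
    toCode = subst (λ k → Trace bl (codeAdj c {k}) S) (sym ∣S∣≡m) (Trace-adj {bl = bl} (λ a b → sym (c≡J a b)) t)

    fromCode : Realised bl″ (S , c) → Trace bl″ (adj (graph J)) S
    fromCode r = Trace-adj {bl = bl″} c≡J (subst (λ k → Trace bl″ (codeAdj c {k}) S) ∣S∣≡m r)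

-- Refinement

module Powers (κ : ℚ) (0≤κ : 0ℚ ≤ℚ κ) (κ≤1 : κ ≤ℚ 1ℚ) where

  *-monoˡ : ∀ {r p q} → 0ℚ ≤ℚ r → p ≤ℚ q → r *ℚ p ≤ℚ r *ℚ q
  *-monoˡ {r} 0≤r = ℚ.*-monoˡ-≤-nonNeg r {{nonNegative 0≤r}}

  *-monoʳ : ∀ {r p q} → 0ℚ ≤ℚ r → p ≤ℚ q → p *ℚ r ≤ℚ q *ℚ r
  *-monoʳ {r} 0≤r = ℚ.*-monoʳ-≤-nonNeg r {{nonNegative 0≤r}}

  0≤ℕ→ℚ : ∀ w → 0ℚ ≤ℚ ℕ→ℚ w
  0≤ℕ→ℚ w = ℚ.nonNegative⁻¹ (ℕ→ℚ w) {{ℚ.normalize-nonNeg w 1}}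

  ≤1⇒*≤ : ∀ {q} x → 0ℚ ≤ℚ x → q ≤ℚ 1ℚ → q *ℚ x ≤ℚ x
  ≤1⇒*≤ x 0≤x q≤1 = ℚ.≤-trans (*-monoʳ 0≤x q≤1) (ℚ.≤-reflexive (ℚ.*-identityˡ x))

  0≤^ : ∀ a → 0ℚ ≤ℚ κ ^ℚ a
  0≤^ zero    = ℚ.nonNegative⁻¹ 1ℚ
  0≤^ (suc a) = subst (_≤ℚ κ *ℚ κ ^ℚ a) (ℚ.*-zeroʳ κ) (*-monoˡ 0≤κ (0≤^ a))

  ^-antitone : ∀ {a b} → a ≤ b → κ ^ℚ b ≤ℚ κ ^ℚ a
  ^-antitone {b = zero}  z≤n = ℚ.≤-refl
  ^-antitone {a} {suc b} a≤b+1 with ℕ.m≤n⇒m<n∨m≡n a≤b+1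
  ... | inj₁ a<b+1 = ℚ.≤-trans (≤1⇒*≤ (κ ^ℚ b) (0≤^ b) κ≤1) (^-antitone (ℕ.s≤s⁻¹ a<b+1))
  ... | inj₂ refl  = ℚ.≤-refl

  ^-step : ∀ {e e″ w w″ w′} → e″ < e → 0ℚ ≤ℚ w → κ *ℚ w ≤ℚ w″ → κ ^ℚ e″ *ℚ w″ ≤ℚ w′ → κ ^ℚ e *ℚ w ≤ℚ w′
  ^-step {e} {e″} {w} {w″} {w′} e″<e 0≤w κw≤w″ κ^e″w″≤w′ = begin
    κ ^ℚ e *ℚ w             ≤⟨ *-monoʳ 0≤w (^-antitone e″<e) ⟩
    (κ *ℚ κ ^ℚ e″) *ℚ w     ≡⟨ cong (_*ℚ w) (ℚ.*-comm κ (κ ^ℚ e″)) ⟩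
    (κ ^ℚ e″ *ℚ κ) *ℚ w     ≡⟨ ℚ.*-assoc (κ ^ℚ e″) κ w ⟩
    κ ^ℚ e″ *ℚ (κ *ℚ w)     ≤⟨ *-monoˡ (0≤^ e″) κw≤w″ ⟩
    κ ^ℚ e″ *ℚ w″           ≤⟨ κ^e″w″≤w′ ⟩
    w′                      ∎
    where open ℚ.≤-Reasoning

nonempty⇒∣∣>0 : ∀ {n} {p : Subset n} → Nonempty p → 0 < ∣ p ∣
nonempty⇒∣∣>0 {p = inside ∷ p}  _                    = s≤s z≤n
nonempty⇒∣∣>0 {p = outside ∷ p} (fsuc x , there x∈p) = nonempty⇒∣∣>0 (x , x∈p)

∣∣>0⇒nonempty : ∀ {n} (p : Subset n) → 0 < ∣ p ∣ → Nonempty p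
∣∣>0⇒nonempty (inside ∷ p)  _      = fzero , here
∣∣>0⇒nonempty (outside ∷ p) 0<∣p∣ with x , x∈p ← ∣∣>0⇒nonempty p 0<∣p∣ = fsuc x , there x∈p

subset-ofSize : ∀ {n} (p : Subset n) w → w ≤ ∣ p ∣ → ∃ λ q → q ⊆ₛ p × ∣ q ∣ ≡ w
subset-ofSize {n} p         zero    _ = ∅ , ⊥⊆ , ∣⊥∣≡0 n
subset-ofSize []            (suc w) ()
subset-ofSize (inside ∷ p)  (suc w) (s≤s w≤∣p∣) with q , q⊆p , ∣q∣≡w ← subset-ofSize p w w≤∣p∣ =
  inside ∷ q , s⊆s q⊆p , cong suc ∣q∣≡w
subset-ofSize (outside ∷ p) (suc w) w<∣p∣ with q , q⊆p , ∣q∣≡w ← subset-ofSize p (suc w) w<∣p∣ =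
  outside ∷ q , out⊆ q⊆p , ∣q∣≡w

minSize-≗ : ∀ {n} K {B B′ : Fin K → Subset n} → B ≗ B′ → minSize K B ≡ minSize K B′
minSize-≗ zero                B≗B′ = refl
minSize-≗ (suc zero)          B≗B′ = cong ∣_∣ (B≗B′ fzero)
minSize-≗ (suc (suc K))       B≗B′ = cong₂ _⊓_ (cong ∣_∣ (B≗B′ fzero)) (minSize-≗ (suc K) (B≗B′ ∘ fsuc))

minSize≤ : ∀ {n} K (B : Fin K → Subset n) i → minSize K B ≤ ∣ B i ∣
minSize≤ (suc zero)    B fzero    = ℕ.≤-refl
minSize≤ (suc (suc K)) B fzero    = ℕ.m⊓n≤m _ _
minSize≤ (suc (suc K)) B (fsuc i) = ℕ.≤-trans (ℕ.m⊓n≤n _ _) (minSize≤ (suc K) (B ∘ fsuc) i)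

minSize>0 : ∀ {n} K (B : Fin K → Subset n) → (∀ i → Nonempty (B i)) → Fin K → 0 < minSize K B
minSize>0 (suc zero)    B B≢∅ _ = nonempty⇒∣∣>0 (B≢∅ fzero)
minSize>0 (suc (suc K)) B B≢∅ _ =
  ℕ.⊓-glb (nonempty⇒∣∣>0 (B≢∅ fzero)) (minSize>0 (suc K) (B ∘ fsuc) (B≢∅ ∘ fsuc) fzero)

minSize-uniform : ∀ {n} K (B C : Fin K → Subset n) → (∀ i → ∣ B i ∣ ≡ minSize K C) → minSize K B ≡ minSize K C
minSize-uniform zero    B C _     = refl
minSize-uniform (suc K) B C ∣B∣≡w = uniform K B ∣B∣≡w
  where
  uniform : ∀ k (B : Fin (suc k) → Subset _) → (∀ i → ∣ B i ∣ ≡ minSize (suc K) C) → minSize (suc k) B ≡ minSize (suc K) C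
  uniform zero    B ∣B∣≡w = ∣B∣≡w fzero
  uniform (suc k) B ∣B∣≡w = trans (cong₂ _⊓_ (∣B∣≡w fzero) (uniform k (B ∘ fsuc) (∣B∣≡w ∘ fsuc))) (ℕ.⊓-idem _)

module Refinement {n} (G : Graph n) (K τ : ℕ) (κ : ℚ) (0≤κ : 0ℚ ≤ℚ κ) (κ≤1 : κ ≤ℚ 1ℚ) where

  open Traces G K
  open Potential G K τ
  open Powers κ 0≤κ κ≤1

  subBlockade : (𝓑 : Blockade G K) (bl : Blocks) → bl ⊆ᴮ block 𝓑 → (∀ i → Nonempty (bl i)) → Blockade G K
  subBlockade 𝓑 bl bl⊆𝓑 bl≢∅ = record { block = bl ; nonempty = bl≢∅ ; disjoint = disjoint′ }
    where
    disjoint′ : ∀ i j → i ≢ j → Empty (bl i ∩ bl j)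
    disjoint′ i j i≢j (x , x∈bl) with x∈i , x∈j ← x∈p∩q⁻ (bl i) (bl j) x∈bl =
      disjoint 𝓑 i j i≢j (x , x∈p∩q⁺ (bl⊆𝓑 i x∈i , bl⊆𝓑 j x∈j))

  Shrinking : Blockade G K → Blocks → Set
  Shrinking 𝓑 bl = bl ⊆ᴮ block 𝓑 × (∀ i → Nonempty (bl i)) ×
                   κ *ℚ ℕ→ℚ (width 𝓑) ≤ℚ ℕ→ℚ (minSize K bl) × potential bl < potential (block 𝓑)

  shrinking? : ∀ 𝓑 bl → Dec (Shrinking 𝓑 bl)
  shrinking? 𝓑 bl = Fin.all? (λ i → bl i ⊆? block 𝓑 i) ×-dec Fin.all? (λ i → nonempty? (bl i)) ×-dec
                    (_ ℚ.≤? _) ×-dec (_ ℕ.<? _)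

  Shrinking-≗ : ∀ {𝓑 bl bl′} → bl ≗ bl′ → Shrinking 𝓑 bl → Shrinking 𝓑 bl′
  Shrinking-≗ {𝓑} bl≗bl′ (bl⊆𝓑 , bl≢∅ , wide , drop) =
    (λ i → ⊆-trans (⊆-reflexive (sym (bl≗bl′ i))) (bl⊆𝓑 i)) ,
    (λ i → subst Nonempty (bl≗bl′ i) (bl≢∅ i)) ,
    subst (λ w → κ *ℚ ℕ→ℚ (width 𝓑) ≤ℚ ℕ→ℚ w) (minSize-≗ K bl≗bl′) wide ,
    subst (_< potential (block 𝓑)) (potential-≗ bl≗bl′) drop

  invariant-or-shrinking : (𝓑 : Blockade G K) → SupportInvariant κ τ 𝓑 ⊎ ∃ (Shrinking 𝓑)
  invariant-or-shrinking 𝓑 with search (enumVec (enumVec enumBool n) K) (shrinking? 𝓑 ∘ lookup)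
  ... | yes (v , shrinking) = inj₂ (lookup v , shrinking)
  ... | no none             = inj₁ invariant
    where
    invariant : SupportInvariant κ τ 𝓑
    invariant 𝓑″ 𝓑″⊆𝓑 wide m m≤τ J S = mk⇔ keep (Trace-mono 𝓑″⊆𝓑)
      where
      keep : InTrace 𝓑 J S → InTrace 𝓑″ J S
      keep t = decidable-stable (trace? (block 𝓑″) S) λ ¬t″ → none (tabulate (block 𝓑″) ,
        Shrinking-≗ {𝓑} (sym ∘ lookup∘tabulate (block 𝓑″))
          (𝓑″⊆𝓑 , nonempty 𝓑″ , wide , potential-drop 𝓑″⊆𝓑 m≤τ J t ¬t″))

  Refined : Blockade G K → ℕ → Set
  Refined 𝓑 e = Σ (Blockade G K) λ 𝓑′ → 𝓑′ ContractionOf 𝓑 × SupportInvariant κ τ 𝓑′ ×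
                  κ ^ℚ e *ℚ ℕ→ℚ (width 𝓑) ≤ℚ ℕ→ℚ (width 𝓑′)

  refine : (𝓑 : Blockade G K) → Acc _<_ (potential (block 𝓑)) → Refined 𝓑 (potential (block 𝓑))
  refine 𝓑 (acc rec) with invariant-or-shrinking 𝓑
  ... | inj₁ invariant = 𝓑 , (λ _ → ⊆-refl) , invariant ,
    ≤1⇒*≤ (ℕ→ℚ (width 𝓑)) (0≤ℕ→ℚ (width 𝓑)) (^-antitone {b = potential (block 𝓑)} z≤n)
  ... | inj₂ (bl , bl⊆𝓑 , bl≢∅ , wide , drop)
      with 𝓑′ , 𝓑′⊆bl , invariant , bound ← refine (subBlockade 𝓑 bl bl⊆𝓑 bl≢∅) (rec drop) =
    𝓑′ , (λ i → ⊆-trans (𝓑′⊆bl i) (bl⊆𝓑 i)) , invariant , ^-step drop (0≤ℕ→ℚ (width 𝓑)) wide bound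

  equalise : (𝓑 : Blockade G K) → Σ (Blockade G K) λ 𝓑′ → 𝓑′ ContractionOf 𝓑 × Equicardinal 𝓑′ × width 𝓑′ ≡ width 𝓑
  equalise 𝓑 = subBlockade 𝓑 q q⊆𝓑 q≢∅ , q⊆𝓑 , (λ i j → trans (∣q∣≡w i) (sym (∣q∣≡w j))) ,
               minSize-uniform K q (block 𝓑) ∣q∣≡w
    where
    w = width 𝓑
    trimmed : ∀ i → ∃ λ q → q ⊆ₛ block 𝓑 i × ∣ q ∣ ≡ w
    trimmed i = subset-ofSize (block 𝓑 i) w (minSize≤ K (block 𝓑) i)
    q : Blocks
    q i = proj₁ (trimmed i)
    q⊆𝓑 : q ⊆ᴮ block 𝓑
    q⊆𝓑 i = proj₁ (proj₂ (trimmed i))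
    ∣q∣≡w : ∀ i → ∣ q i ∣ ≡ w
    ∣q∣≡w i = proj₂ (proj₂ (trimmed i))
    q≢∅ : ∀ i → Nonempty (q i)
    q≢∅ i = ∣∣>0⇒nonempty (q i) (subst (0 <_) (sym (∣q∣≡w i)) (minSize>0 K (block 𝓑) (nonempty 𝓑) i))

  invariant-sameWidth : ∀ {𝓑 𝓑′ : Blockade G K} → 𝓑′ ContractionOf 𝓑 → width 𝓑′ ≡ width 𝓑 →
                        SupportInvariant κ τ 𝓑 → SupportInvariant κ τ 𝓑′
  invariant-sameWidth {𝓑} {𝓑′} 𝓑′⊆𝓑 w′≡w invariant 𝓑″ 𝓑″⊆𝓑′ wide m m≤τ J S =
    invariant 𝓑″ (λ i → ⊆-trans (𝓑″⊆𝓑′ i) (𝓑′⊆𝓑 i))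
              (subst (λ x → κ *ℚ ℕ→ℚ x ≤ℚ ℕ→ℚ (width 𝓑″)) w′≡w wide) m m≤τ J S
    ⇔-∘ ⇔-sym (invariant 𝓑′ 𝓑′⊆𝓑 selfWide m m≤τ J S)
    where
    selfWide : κ *ℚ ℕ→ℚ (width 𝓑) ≤ℚ ℕ→ℚ (width 𝓑′)
    selfWide = subst (λ x → κ *ℚ ℕ→ℚ (width 𝓑) ≤ℚ ℕ→ℚ x) (sym w′≡w)
                     (≤1⇒*≤ (ℕ→ℚ (width 𝓑)) (0≤ℕ→ℚ (width 𝓑)) κ≤1)

mainTheorem6 : (τ : ℕ) → 1 ≤ℕ τ → (κ : ℚ) → 0ℚ <ℚ κ → κ ≤ℚ 1ℚ →
    ∀ {n} (G : Graph n) (K : ℕ) (𝓑 : Blockade G K) →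
    Σ (Blockade G K) λ 𝓑' →
      𝓑' ContractionOf 𝓑 × Equicardinal 𝓑' × SupportInvariant κ τ 𝓑' ×
      ((κ ^ℚ (2 ^ K * τ ^ τ)) *ℚ ℕ→ℚ (width 𝓑) ≤ℚ ℕ→ℚ (width 𝓑'))
mainTheorem6 τ _ κ 0<κ κ≤1 G K 𝓑 =
  let open Refinement G K τ κ (ℚ.<⇒≤ 0<κ) κ≤1
      open Potential G K τ
      open Powers κ (ℚ.<⇒≤ 0<κ) κ≤1
      open ℚ.≤-Reasoning
      𝓑₁ , 𝓑₁⊆𝓑 , invariant , bound = refine 𝓑 (<-wellFounded _)
      𝓑′ , 𝓑′⊆𝓑₁ , equicardinal , w′≡w₁ = equalise 𝓑₁
  in 𝓑′ , (λ i → ⊆-trans (𝓑′⊆𝓑₁ i) (𝓑₁⊆𝓑 i)) , equicardinal ,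
     invariant-sameWidth {𝓑₁} {𝓑′} 𝓑′⊆𝓑₁ w′≡w₁ invariant ,
     (begin
       κ ^ℚ (2 ^ K * τ ^ τ) *ℚ ℕ→ℚ (width 𝓑)      ≤⟨ *-monoʳ (0≤ℕ→ℚ (width 𝓑)) (^-antitone (potential-≤ (block 𝓑))) ⟩
       κ ^ℚ potential (block 𝓑) *ℚ ℕ→ℚ (width 𝓑) ≤⟨ bound ⟩
       ℕ→ℚ (width 𝓑₁)                            ≡⟨ cong ℕ→ℚ (sym w′≡w₁) ⟩
       ℕ→ℚ (width 𝓑′)                            ∎)
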